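{- Let $M$ be a matroid without loops and without coloops on ground set $E$, and let $X$ be a cyclic flat of $M$. Then $C_M(X)=C_{M/X}(\emptyset)$ and $F_M(X)=F_{M|X}(X)$.
   Context: A flat $X$ of a matroid $N$ with ground set $E_N$ is cyclic if $N|X$ has no coloops. For a flat $Y$ of $N$, $\operatorname{ess}_N(Y)$ denotes the cyclic flat obtained from $Y$ by removing the coloops of $N|Y$; $\operatorname{cl}_N$ is the closure operator. For a cyclic flat $Z$ of $N$, the cloud polynomial is $C_N(Z)=\sum_{Y}x^{r_N(E_N)-r_N(Y)}$ over all flats $Y$ of $N$ with $\operatorname{ess}_N(Y)=Z$, and the flock polynomial is $F_N(Z)=\sum_{Y}y^{|Y|-r_N(Y)}$ over all $Y\subseteq E_N$ with $\operatorname{cl}_N(Y)=Z$. $M/X$ is the contraction (ground set $E\setminus X$) and $M|X$ the restriction. -}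

module Defs where

open import Data.Nat using (ℕ; zero; suc; _≤_; _<_; _∸_; _+_)
import Data.Nat.Properties as ℕP
open import Data.Bool using (Bool; true; false)
import Data.Bool.Properties as BoolP
open import Data.Fin using (Fin)
open import Data.Fin.Subset
open import Data.Fin.Subset.Properties using (_∈?_; _⊆?_)
open import Data.Fin.Properties using (all?)
open import Data.Vec using (Vec; []; _∷_)
import Data.Vec.Properties as VecP
open import Data.List using (List; []; _∷_; _++_; map; filter; length)
open import Data.Product using (_×_; _,_)
open import Relation.Nullary using (Dec; yes; no; ¬_)
open import Relation.Nullary.Decidable using (_×-dec_; _→-dec_; ¬?)
open import Relation.Unary using (Pred; Decidable)
open import Relation.Binary.PropositionalEquality using (_≡_)
import Agda.Primitive

record Matroid (n : ℕ) : Set where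
  field
    rank         : Subset n → ℕ
    rank-bound   : ∀ A → rank A ≤ ∣ A ∣
    rank-mono    : ∀ A B → A ⊆ B → rank A ≤ rank B
    rank-submod  : ∀ A B → rank (A ∪ B) + rank (A ∩ B) ≤ rank A + rank B
open Matroid public

Loopless : ∀ {n} → Matroid n → Set
Loopless {n} M = ∀ (e : Fin n) → rank M ⁅ e ⁆ ≡ 1

Coloopless : ∀ {n} → Matroid n → Set
Coloopless {n} M = ∀ (e : Fin n) → rank M (⊤ - e) ≡ rank M ⊤

-- A matroid "N" living on a ground set G ⊆ Fin n, given by a rank
-- function ρ (only ever evaluated on subsets of G).  This lets us treat
-- M, its restriction M|X and its contraction M/X uniformly.

record Minor (n : ℕ) : Set where
  constructor minor
  field
    ground : Subset n
    rk     : Subset n → ℕ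
open Minor public

whole : ∀ {n} → Matroid n → Minor n
whole M = minor ⊤ (rank M)

restrict : ∀ {n} → Matroid n → Subset n → Minor n
restrict M X = minor X (rank M)

contract : ∀ {n} → Matroid n → Subset n → Minor n
contract M X = minor (∁ X) (λ A → rank M (A ∪ X) ∸ rank M X)

module _ {n : ℕ} (N : Minor n) where
  private
    G = ground N
    ρ = rk N

  IsFlat : Subset n → Set
  IsFlat Y = (Y ⊆ G) × (∀ (e : Fin n) → e ∈ G → e ∉ Y → ρ Y < ρ (Y ∪ ⁅ e ⁆))

  NotColoopIn : Subset n → Fin n → Set
  NotColoopIn Y e = ρ (Y - e) ≡ ρ Y

  IsCyclicFlat : Subset n → Set
  IsCyclicFlat X = IsFlat X × (∀ (e : Fin n) → e ∈ X → NotColoopIn X e)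

  private
    tab : (Fin n → Bool) → Subset n
    tab = Data.Vec.tabulate

    ⌊_⌋ : ∀ {P : Set} → Dec P → Bool
    ⌊ yes _ ⌋ = true
    ⌊ no _ ⌋  = false

  cl : Subset n → Subset n
  cl Y = tab (λ e → ⌊ (e ∈? G) ×-dec (ρ (Y ∪ ⁅ e ⁆) ℕP.≟ ρ Y) ⌋)

  ess : Subset n → Subset n
  ess Y = tab (λ e → ⌊ (e ∈? Y) ×-dec (ρ (Y - e) ℕP.≟ ρ Y) ⌋)

  isFlat? : Decidable IsFlat
  isFlat? Y = (Y ⊆? G) ×-dec
    all? (λ e → (e ∈? G) →-dec ((¬? (e ∈? Y)) →-dec (ρ Y ℕP.<? ρ (Y ∪ ⁅ e ⁆))))


allSubsets : ∀ n → List (Subset n)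
allSubsets zero    = [] ∷ []
allSubsets (suc n) = map (true ∷_) (allSubsets n) ++ map (false ∷_) (allSubsets n)

count : ∀ {n} {P : Pred (Subset n) Agda.Primitive.lzero} → Decidable P → ℕ
count {n} P? = length (filter P? (allSubsets n))

_≟ˢ_ : ∀ {n} (A B : Subset n) → Dec (A ≡ B)
_≟ˢ_ = VecP.≡-dec BoolP._≟_

-- Polynomials with ℕ coefficients are represented by their coefficient
-- sequence ℕ → ℕ ; two polynomials are equal iff all coefficients agree.

-- Coefficient of x^k in the cloud polynomial C_N(Z):
--   #{ Y flat of N : ess_N(Y) = Z, r_N(E_N) - r_N(Y) = k }
cloud : ∀ {n} → Minor n → Subset n → ℕ → ℕ
cloud N Z k = count (λ Y → isFlat? N Y ×-dec ((ess N Y ≟ˢ Z)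
                 ×-dec (rk N (ground N) ∸ rk N Y ℕP.≟ k)))

-- Coefficient of y^k in the flock polynomial F_N(Z):
--   #{ Y ⊆ E_N : cl_N(Y) = Z, |Y| - r_N(Y) = k }
flock : ∀ {n} → Minor n → Subset n → ℕ → ℕ
flock N Z k = count (λ Y → (Y ⊆? ground N) ×-dec ((cl N Y ≟ˢ Z)
                 ×-dec (∣ Y ∣ ∸ rk N Y ℕP.≟ k)))

-- Every flat Y of M with ess Y = X contains X, and Y ↦ Y ─ X matches these flats with the
-- flats of M/X whose ess is empty, preserving corank: ranks in M/X are r (· ∪ X) ∸ r X, the
-- coloops of (M/X)|(Y ─ X) are the coloops of M|Y outside X, and M|Y has no coloop inside X
-- because X is cyclic (submodularity).  For flocks, as X is a flat, cl_M Y = X holds iff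
-- Y ⊆ X and cl_{M|X} Y = X, with the same nullity |Y| ∸ r Y on both sides.

module Submission where

open import Defs
open import Data.Nat using (ℕ; suc; _+_; _∸_; _≤_; _<_; _≟_)
open import Data.Nat.Properties
  using (≤-reflexive; ≤-antisym; <⇒≱; ≰⇒>; +-comm; +-mono-≤; +-monoˡ-≤; +-cancelˡ-≤;
         ∸-monoˡ-≤; ∸-monoˡ-<; ∸-cancelʳ-≡; ∸-+-assoc; m+[n∸m]≡n; module ≤-Reasoning)
open import Data.Bool using (true; false; _xor_)
open import Data.Bool.Properties using (xor-identityʳ)
open import Data.Fin using (Fin)
open import Data.Fin.Subset
open import Data.Fin.Subset.Properties
  using (_∈?_; ∈⊤; ⊆⊤; ∉⊥; x∈⁅y⁆⇒x≡y; ⊆-trans; ⊆-reflexive; ⊆-antisym; drop-∷-⊆; drop-there;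
         Empty-unique; x∈∁p⇒x∉p; x∉p⇒x∈∁p; p∪∁p≡⊤; ∪-comm; ∪-assoc; p⊆p∪q; q⊆p∪q;
         x∈p∪q⁻; x∈p∩q⁺; x∈p∩q⁻; p∩q⊆p; ∩-idem; x∈p∧x∉q⇒x∈p─q; p─q⊆p;
         p─q─r≡p─r─q; x∈p∧x≢y⇒x∈p-y)
open import Data.Vec using (_∷_; []; zipWith; lookup; here; there)
open import Data.Vec.Properties using (lookup∘tabulate; []=⇒lookup; lookup⇒[]=)
open import Data.List using (List; []; _∷_; _++_; map; filter; length)
open import Data.List.Properties using (filter-++; length-++; filter-≐)
open import Data.Product using (_×_; _,_; proj₁; proj₂)
open import Data.Product.Function.NonDependent.Propositional using (_×-⇔_)
open import Data.Sum using ([_,_])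
open import Function using (_∘_; id)
open import Function.Bundles using (_⇔_; mk⇔; Equivalence)
open import Relation.Nullary using (yes; no; does; contradiction)
open import Relation.Nullary.Decidable using (_×-dec_)
open import Relation.Unary using (Pred; Decidable; _≐_)
open import Relation.Binary.PropositionalEquality
  using (_≡_; refl; sym; trans; cong; cong₂; subst; subst₂; module ≡-Reasoning)
open import Level using (0ℓ)

open Equivalence using (to; from)

[m∸o]∸[n∸o]≡m∸n : ∀ m {n o} → o ≤ n → (m ∸ o) ∸ (n ∸ o) ≡ m ∸ n
[m∸o]∸[n∸o]≡m∸n m {n} {o} o≤n = trans (∸-+-assoc m o (n ∸ o)) (cong (m ∸_) (m+[n∸m]≡n o≤n))

m∸o<n∸o⇒m<n : ∀ {m n} o → m ∸ o < n ∸ o → m < n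
m∸o<n∸o⇒m<n o m∸o<n∸o = ≰⇒> (λ n≤m → <⇒≱ m∸o<n∸o (∸-monoˡ-≤ o n≤m))

x∈p─q⇒x∉q : ∀ {n} {p q : Subset n} {x} → x ∈ p ─ q → x ∉ q
x∈p─q⇒x∉q {p = inside ∷ p} {outside ∷ q} here        ()
x∈p─q⇒x∉q {p = _ ∷ p}      {_ ∷ q}       (there x∈) (there x∈q) = x∈p─q⇒x∉q x∈ x∈q

module _ {n : ℕ} where

  p─q⊆∁q : ∀ (p q : Subset n) → p ─ q ⊆ ∁ q
  p─q⊆∁q p q = x∉p⇒x∈∁p ∘ x∈p─q⇒x∉q

  p⊆q⇒p─r⊆q─r : ∀ {p q : Subset n} r → p ⊆ q → p ─ r ⊆ q ─ r
  p⊆q⇒p─r⊆q─r {p} r p⊆q x∈ = x∈p∧x∉q⇒x∈p─q (p⊆q (p─q⊆p p r x∈)) (x∈p─q⇒x∉q x∈)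

  p⊆q∧x∉p⇒p⊆q-x : ∀ {p q : Subset n} {x} → p ⊆ q → x ∉ p → p ⊆ q - x
  p⊆q∧x∉p⇒p⊆q-x {p} p⊆q x∉p y∈p = x∈p∧x≢y⇒x∈p-y (p⊆q y∈p) (λ { refl → x∉p y∈p })

  x∈p⇒⁅x⁆⊆p : ∀ {p : Subset n} {x} → x ∈ p → ⁅ x ⁆ ⊆ p
  x∈p⇒⁅x⁆⊆p {p} {x} x∈p y∈ = subst (_∈ p) (sym (x∈⁅y⁆⇒x≡y x y∈)) x∈p

  q⊆p⇒p∪q≡p : ∀ {p q : Subset n} → q ⊆ p → p ∪ q ≡ p
  q⊆p⇒p∪q≡p {p} {q} q⊆p = ⊆-antisym ([ id , q⊆p ] ∘ x∈p∪q⁻ p q) (p⊆p∪q q)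

  q⊆p⇒p─q∪q≡p : ∀ {p q : Subset n} → q ⊆ p → (p ─ q) ∪ q ≡ p
  q⊆p⇒p─q∪q≡p {p} {q} q⊆p = ⊆-antisym ([ p─q⊆p p q , q⊆p ] ∘ x∈p∪q⁻ (p ─ q) q) p⊆p─q∪q
    where
    p⊆p─q∪q : p ⊆ (p ─ q) ∪ q
    p⊆p─q∪q {x} x∈p with x ∈? q
    ... | yes x∈q = q⊆p∪q (p ─ q) q x∈q
    ... | no  x∉q = p⊆p∪q q (x∈p∧x∉q⇒x∈p─q x∈p x∉q)

  x∈p⇒p-x∪⁅x⁆≡p : ∀ {p : Subset n} {x} → x ∈ p → (p - x) ∪ ⁅ x ⁆ ≡ p
  x∈p⇒p-x∪⁅x⁆≡p = q⊆p⇒p─q∪q≡p ∘ x∈p⇒⁅x⁆⊆p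

  p─p≡⊥ : ∀ (p : Subset n) → p ─ p ≡ ⊥
  p─p≡⊥ p = Empty-unique λ (x , x∈) → x∈p─q⇒x∉q x∈ (p─q⊆p p p x∈)

  p─q≡⊥⇒p⊆q : ∀ {p q : Subset n} → p ─ q ≡ ⊥ → p ⊆ q
  p─q≡⊥⇒p⊆q {p} {q} eq {x} x∈p with x ∈? q
  ... | yes x∈q = x∈q
  ... | no  x∉q = contradiction (subst (x ∈_) eq (x∈p∧x∉q⇒x∈p─q x∈p x∉q)) ∉⊥

-- Symmetric difference: an involution of Subset n agreeing with  p ↦ p ─ q  on the supersets
-- of q, so counts can be transported along it.

_⊕_ : ∀ {n} → Subset n → Subset n → Subset n
_⊕_ = zipWith _xor_

q⊆p⇒p⊕q≡p─q : ∀ {n} {p q : Subset n} → q ⊆ p → p ⊕ q ≡ p ─ q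
q⊆p⇒p⊕q≡p─q {p = []}          {[]}          _   = refl
q⊆p⇒p⊕q≡p─q {p = s ∷ p}       {outside ∷ q} q⊆p = cong₂ _∷_ (xor-identityʳ s) (q⊆p⇒p⊕q≡p─q (drop-∷-⊆ q⊆p))
q⊆p⇒p⊕q≡p─q {p = inside ∷ p}  {inside ∷ q}  q⊆p = cong (outside ∷_) (q⊆p⇒p⊕q≡p─q (drop-∷-⊆ q⊆p))
q⊆p⇒p⊕q≡p─q {p = outside ∷ p} {inside ∷ q}  q⊆p with q⊆p here
... | ()

p⊕q⊆∁q⇒q⊆p : ∀ {n} {p q : Subset n} → p ⊕ q ⊆ ∁ q → q ⊆ p
p⊕q⊆∁q⇒q⊆p {p = inside ∷ p}  h here = here
p⊕q⊆∁q⇒q⊆p {p = outside ∷ p} h here with h here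
... | ()
p⊕q⊆∁q⇒q⊆p {p = _ ∷ p} {_ ∷ q} h (there x∈q) = there (p⊕q⊆∁q⇒q⊆p (drop-there ∘ h ∘ there) x∈q)

count-≐ : ∀ {n} {P Q : Pred (Subset n) 0ℓ} {P? : Decidable P} {Q? : Decidable Q} →
          P ≐ Q → count P? ≡ count Q?
count-≐ {n} {P? = P?} {Q?} P≐Q = cong length (filter-≐ P? Q? P≐Q (allSubsets n))

length-filter-map : ∀ {A B : Set} {P : Pred A 0ℓ} (P? : Decidable P) (f : B → A) (xs : List B) →
                    length (filter P? (map f xs)) ≡ length (filter (P? ∘ f) xs)
length-filter-map P? f []       = refl
length-filter-map P? f (x ∷ xs) with does (P? (f x))
... | true  = cong suc (length-filter-map P? f xs)
... | false = length-filter-map P? f xs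

count-∷ : ∀ {n} {P : Pred (Subset (suc n)) 0ℓ} (P? : Decidable P) →
          count P? ≡ count (λ p → P? (inside ∷ p)) + count (λ p → P? (outside ∷ p))
count-∷ {n} P? = begin
  length (filter P? (map (inside ∷_) ps ++ map (outside ∷_) ps))
    ≡⟨ cong length (filter-++ P? (map (inside ∷_) ps) (map (outside ∷_) ps)) ⟩
  length (filter P? (map (inside ∷_) ps) ++ filter P? (map (outside ∷_) ps))
    ≡⟨ length-++ (filter P? (map (inside ∷_) ps)) ⟩
  length (filter P? (map (inside ∷_) ps)) + length (filter P? (map (outside ∷_) ps))
    ≡⟨ cong₂ _+_ (length-filter-map P? (inside ∷_) ps) (length-filter-map P? (outside ∷_) ps) ⟩
  count (λ p → P? (inside ∷ p)) + count (λ p → P? (outside ∷ p)) ∎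
  where
  open ≡-Reasoning
  ps = allSubsets n

count-⊕ : ∀ {n} (q : Subset n) {P : Pred (Subset n) 0ℓ} (P? : Decidable P) →
          count (λ p → P? (p ⊕ q)) ≡ count P?
count-⊕ []            P? = count-≐ {P? = λ p → P? (p ⊕ [])} {P?} ((λ { {[]} → id }) , (λ { {[]} → id }))
count-⊕ (outside ∷ q) P? = begin
  count (λ p → P? (p ⊕ (outside ∷ q)))
    ≡⟨ count-∷ (λ p → P? (p ⊕ (outside ∷ q))) ⟩
  count (λ p → P? (inside ∷ (p ⊕ q))) + count (λ p → P? (outside ∷ (p ⊕ q)))
    ≡⟨ cong₂ _+_ (count-⊕ q (λ p → P? (inside ∷ p))) (count-⊕ q (λ p → P? (outside ∷ p))) ⟩
  count (λ p → P? (inside ∷ p)) + count (λ p → P? (outside ∷ p))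
    ≡⟨ count-∷ P? ⟨
  count P? ∎
  where open ≡-Reasoning
count-⊕ (inside ∷ q)  P? = begin
  count (λ p → P? (p ⊕ (inside ∷ q)))
    ≡⟨ count-∷ (λ p → P? (p ⊕ (inside ∷ q))) ⟩
  count (λ p → P? (outside ∷ (p ⊕ q))) + count (λ p → P? (inside ∷ (p ⊕ q)))
    ≡⟨ +-comm (count (λ p → P? (outside ∷ (p ⊕ q)))) _ ⟩
  count (λ p → P? (inside ∷ (p ⊕ q))) + count (λ p → P? (outside ∷ (p ⊕ q)))
    ≡⟨ cong₂ _+_ (count-⊕ q (λ p → P? (inside ∷ p))) (count-⊕ q (λ p → P? (outside ∷ p))) ⟩
  count (λ p → P? (inside ∷ p)) + count (λ p → P? (outside ∷ p))
    ≡⟨ count-∷ P? ⟨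
  count P? ∎
  where open ≡-Reasoning

InCloud : ∀ {n} → Minor n → Subset n → ℕ → Subset n → Set
InCloud N Z k Y = IsFlat N Y × (ess N Y ≡ Z × rk N (ground N) ∸ rk N Y ≡ k)

InFlock : ∀ {n} → Minor n → Subset n → ℕ → Subset n → Set
InFlock N Z k Y = Y ⊆ ground N × (cl N Y ≡ Z × ∣ Y ∣ ∸ rk N Y ≡ k)

-- The tests inside  ess  and  cl  go through a private Bool-valued view of  Dec ; abstracting
-- over the decision exposes it.
module _ {n : ℕ} (N : Minor n) where

  ∈-ess : ∀ {Y e} → e ∈ ess N Y ⇔ (e ∈ Y × NotColoopIn N Y e)
  ∈-ess {Y} {e} with (e ∈? Y) ×-dec (rk N (Y - e) ≟ rk N Y)
                   | trans (sym (lookup∘tabulate _ e)) (refl {x = lookup (ess N Y) e})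
  ... | yes p | eq = mk⇔ (λ _ → p) (λ _ → lookup⇒[]= e _ (sym eq))
  ... | no ¬p | eq = mk⇔ (λ e∈ → contradiction (trans eq ([]=⇒lookup e∈)) λ ()) (λ p → contradiction p ¬p)

  ∈-cl : ∀ {Y e} → e ∈ cl N Y ⇔ (e ∈ ground N × rk N (Y ∪ ⁅ e ⁆) ≡ rk N Y)
  ∈-cl {Y} {e} with (e ∈? ground N) ×-dec (rk N (Y ∪ ⁅ e ⁆) ≟ rk N Y)
                  | trans (sym (lookup∘tabulate _ e)) (refl {x = lookup (cl N Y) e})
  ... | yes p | eq = mk⇔ (λ _ → p) (λ _ → lookup⇒[]= e _ (sym eq))
  ... | no ¬p | eq = mk⇔ (λ e∈ → contradiction (trans eq ([]=⇒lookup e∈)) λ ()) (λ p → contradiction p ¬p)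

  ess⊆ : ∀ Y → ess N Y ⊆ Y
  ess⊆ Y = proj₁ ∘ to ∈-ess

module _ {n : ℕ} (M : Matroid n) where

  private
    r : Subset n → ℕ
    r = rank M

    W : Minor n
    W = whole M

  Spans : Subset n → Fin n → Set
  Spans A e = r (A ∪ ⁅ e ⁆) ≤ r A

  ∈⇒rank∪⁅⁆≡rank : ∀ {A e} → e ∈ A → r (A ∪ ⁅ e ⁆) ≡ r A
  ∈⇒rank∪⁅⁆≡rank = cong r ∘ q⊆p⇒p∪q≡p ∘ x∈p⇒⁅x⁆⊆p

  spans-mono : ∀ {A B e} → A ⊆ B → Spans A e → Spans B e
  spans-mono {A} {B} {e} A⊆B A-spans = +-cancelˡ-≤ (r A) (r (B ∪ ⁅ e ⁆)) (r B) (begin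
    r A + r (B ∪ ⁅ e ⁆)                   ≡⟨ +-comm (r A) _ ⟩
    r (B ∪ ⁅ e ⁆) + r A                   ≤⟨ +-mono-≤ (rank-mono M _ _ B∪e⊆) (rank-mono M _ _ A⊆) ⟩
    r ((A ∪ ⁅ e ⁆) ∪ B) + r ((A ∪ ⁅ e ⁆) ∩ B) ≤⟨ rank-submod M (A ∪ ⁅ e ⁆) B ⟩
    r (A ∪ ⁅ e ⁆) + r B                   ≤⟨ +-monoˡ-≤ (r B) A-spans ⟩
    r A + r B                             ∎)
    where
    open ≤-Reasoning
    B∪e⊆ : B ∪ ⁅ e ⁆ ⊆ (A ∪ ⁅ e ⁆) ∪ B
    B∪e⊆ = [ q⊆p∪q (A ∪ ⁅ e ⁆) B , p⊆p∪q B ∘ q⊆p∪q A ⁅ e ⁆ ] ∘ x∈p∪q⁻ B ⁅ e ⁆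
    A⊆ : A ⊆ (A ∪ ⁅ e ⁆) ∩ B
    A⊆ x∈A = x∈p∩q⁺ (p⊆p∪q ⁅ e ⁆ x∈A , A⊆B x∈A)

  cyclic⇒⊆ess : ∀ {X Y} → (∀ e → e ∈ X → NotColoopIn W X e) → X ⊆ Y → X ⊆ ess W Y
  cyclic⇒⊆ess {X} {Y} X-cyclic X⊆Y {e} e∈X =
    from (∈-ess W) (e∈Y , ≤-antisym (rank-mono M _ _ (p─q⊆p Y ⁅ e ⁆)) rY≤rY-e)
    where
    open ≤-Reasoning
    e∈Y : e ∈ Y
    e∈Y = X⊆Y e∈X
    X-e-spans : Spans (X - e) e
    X-e-spans = ≤-reflexive (trans (cong r (x∈p⇒p-x∪⁅x⁆≡p e∈X)) (sym (X-cyclic e e∈X)))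
    rY≤rY-e : r Y ≤ r (Y - e)
    rY≤rY-e = begin
      r Y                ≡⟨ cong r (x∈p⇒p-x∪⁅x⁆≡p e∈Y) ⟨
      r ((Y - e) ∪ ⁅ e ⁆) ≤⟨ spans-mono (p⊆q⇒p─r⊆q─r ⁅ e ⁆ X⊆Y) X-e-spans ⟩
      r (Y - e)          ∎

  flat⇒cl⊆ : ∀ {X Y} → IsFlat W X → Y ⊆ X → cl W Y ⊆ X
  flat⇒cl⊆ {X} {Y} (_ , X-flat) Y⊆X {e} e∈cl with e ∈? X
  ... | yes e∈X = e∈X
  ... | no  e∉X = contradiction (spans-mono Y⊆X (≤-reflexive (proj₂ (to (∈-cl W) e∈cl))))
                                (<⇒≱ (X-flat e ∈⊤ e∉X))

  ⊆cl : ∀ Y → Y ⊆ cl W Y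
  ⊆cl Y e∈Y = from (∈-cl W) (∈⊤ , ∈⇒rank∪⁅⁆≡rank e∈Y)

  cl-restrict : ∀ X Y → cl (restrict M X) Y ≡ cl W Y ∩ X
  cl-restrict X Y = ⊆-antisym ⊆∩ ∩⊆
    where
    ⊆∩ : cl (restrict M X) Y ⊆ cl W Y ∩ X
    ⊆∩ e∈ with to (∈-cl (restrict M X)) e∈
    ... | e∈X , spanned = x∈p∩q⁺ (from (∈-cl W) (∈⊤ , spanned) , e∈X)
    ∩⊆ : cl W Y ∩ X ⊆ cl (restrict M X) Y
    ∩⊆ e∈ with x∈p∩q⁻ (cl W Y) X e∈
    ... | e∈cl , e∈X = from (∈-cl (restrict M X)) (e∈X , proj₂ (to (∈-cl W) e∈cl))

  cl≡⇔cl-restrict≡ : ∀ {X Y} → IsFlat W X → cl W Y ≡ X ⇔ (Y ⊆ X × cl (restrict M X) Y ≡ X)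
  cl≡⇔cl-restrict≡ {X} {Y} X-flat = mk⇔ ⇒ ⇐
    where
    ⇒ : cl W Y ≡ X → Y ⊆ X × cl (restrict M X) Y ≡ X
    ⇒ refl = ⊆cl Y , trans (cl-restrict (cl W Y) Y) (∩-idem (cl W Y))
    ⇐ : Y ⊆ X × cl (restrict M X) Y ≡ X → cl W Y ≡ X
    ⇐ (Y⊆X , eq) = ⊆-antisym (flat⇒cl⊆ X-flat Y⊆X)
                             (⊆-trans (⊆-reflexive (trans (sym eq) (cl-restrict X Y))) (p∩q⊆p (cl W Y) X))

  inFlock-restrict : ∀ {X Y k} → IsFlat W X → InFlock W X k Y ⇔ InFlock (restrict M X) X k Y
  inFlock-restrict X-flat = mk⇔
    (λ (_ , cl≡X , nullity) → let Y⊆X , cl≡X′ = to (cl≡⇔cl-restrict≡ X-flat) cl≡X in Y⊆X , cl≡X′ , nullity)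
    (λ (Y⊆X , cl≡X , nullity) → ⊆⊤ , from (cl≡⇔cl-restrict≡ X-flat) (Y⊆X , cl≡X) , nullity)

  flock-restrict : ∀ {X} → IsFlat W X → ∀ k → flock W X k ≡ flock (restrict M X) X k
  flock-restrict X-flat k = count-≐ {n} (to (inFlock-restrict X-flat) , from (inFlock-restrict X-flat))

module _ {n : ℕ} (M : Matroid n) (X : Subset n) where

  private
    r : Subset n → ℕ
    r = rank M

    W C : Minor n
    W = whole M
    C = contract M X

  rank-contract : ∀ {A} → X ⊆ A → rk C (A ─ X) ≡ r A ∸ r X
  rank-contract X⊆A = cong (λ B → r B ∸ r X) (q⊆p⇒p─q∪q≡p X⊆A)

  rank-contract-∪⁅⁆ : ∀ {A e} → X ⊆ A → rk C ((A ─ X) ∪ ⁅ e ⁆) ≡ r (A ∪ ⁅ e ⁆) ∸ r X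
  rank-contract-∪⁅⁆ {A} {e} X⊆A = cong (λ B → r B ∸ r X) (begin
    ((A ─ X) ∪ ⁅ e ⁆) ∪ X ≡⟨ ∪-assoc (A ─ X) ⁅ e ⁆ X ⟩
    (A ─ X) ∪ (⁅ e ⁆ ∪ X) ≡⟨ cong ((A ─ X) ∪_) (∪-comm ⁅ e ⁆ X) ⟩
    (A ─ X) ∪ (X ∪ ⁅ e ⁆) ≡⟨ ∪-assoc (A ─ X) X ⁅ e ⁆ ⟨
    ((A ─ X) ∪ X) ∪ ⁅ e ⁆ ≡⟨ cong (_∪ ⁅ e ⁆) (q⊆p⇒p─q∪q≡p X⊆A) ⟩
    A ∪ ⁅ e ⁆             ∎)
    where open ≡-Reasoning

  rank-contract-─⁅⁆ : ∀ {A e} → X ⊆ A → e ∉ X → rk C ((A ─ X) - e) ≡ r (A - e) ∸ r X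
  rank-contract-─⁅⁆ {A} {e} X⊆A e∉X =
    trans (cong (rk C) (p─q─r≡p─r─q A X ⁅ e ⁆)) (rank-contract (p⊆q∧x∉p⇒p⊆q-x X⊆A e∉X))

  corank-contract : ∀ {A} → X ⊆ A → rk C (ground C) ∸ rk C (A ─ X) ≡ r ⊤ ∸ r A
  corank-contract {A} X⊆A = begin
    (r (∁ X ∪ X) ∸ r X) ∸ rk C (A ─ X) ≡⟨ cong₂ (λ B m → (r B ∸ r X) ∸ m) ∁X∪X≡⊤ (rank-contract X⊆A) ⟩
    (r ⊤ ∸ r X) ∸ (r A ∸ r X)         ≡⟨ [m∸o]∸[n∸o]≡m∸n (r ⊤) (rank-mono M X A X⊆A) ⟩
    r ⊤ ∸ r A                         ∎
    where
    open ≡-Reasoning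
    ∁X∪X≡⊤ : ∁ X ∪ X ≡ ⊤
    ∁X∪X≡⊤ = trans (∪-comm (∁ X) X) (p∪∁p≡⊤ X)

  flat-contract : ∀ {Y} → X ⊆ Y → IsFlat W Y ⇔ IsFlat C (Y ─ X)
  flat-contract {Y} X⊆Y = mk⇔ ⇒ ⇐
    where
    rX≤rY : r X ≤ r Y
    rX≤rY = rank-mono M X Y X⊆Y
    ⇒ : IsFlat W Y → IsFlat C (Y ─ X)
    ⇒ (_ , Y-flat) = p─q⊆∁q Y X , λ e e∈∁X e∉Y─X →
      let e∉Y = λ e∈Y → e∉Y─X (x∈p∧x∉q⇒x∈p─q e∈Y (x∈∁p⇒x∉p e∈∁X)) in
      subst₂ _<_ (sym (rank-contract X⊆Y)) (sym (rank-contract-∪⁅⁆ X⊆Y))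
             (∸-monoˡ-< (Y-flat e ∈⊤ e∉Y) rX≤rY)
    ⇐ : IsFlat C (Y ─ X) → IsFlat W Y
    ⇐ (_ , Y─X-flat) = ⊆⊤ , λ e _ e∉Y →
      m∸o<n∸o⇒m<n (r X) (subst₂ _<_ (rank-contract X⊆Y) (rank-contract-∪⁅⁆ X⊆Y)
                          (Y─X-flat e (x∉p⇒x∈∁p (e∉Y ∘ X⊆Y)) (e∉Y ∘ p─q⊆p Y X)))

  notColoop-contract : ∀ {Y e} → X ⊆ Y → e ∉ X → NotColoopIn C (Y ─ X) e ⇔ NotColoopIn W Y e
  notColoop-contract {Y} {e} X⊆Y e∉X = mk⇔
    (λ eq → ∸-cancelʳ-≡ (rank-mono M X (Y - e) (p⊆q∧x∉p⇒p⊆q-x X⊆Y e∉X)) (rank-mono M X Y X⊆Y)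
                        (trans (sym (rank-contract-─⁅⁆ X⊆Y e∉X)) (trans eq (rank-contract X⊆Y))))
    (λ eq → trans (rank-contract-─⁅⁆ X⊆Y e∉X) (trans (cong (_∸ r X) eq) (sym (rank-contract X⊆Y))))

  ess-contract : ∀ {Y} → X ⊆ Y → ess C (Y ─ X) ≡ ess W Y ─ X
  ess-contract {Y} X⊆Y = ⊆-antisym ⊆─ ─⊆
    where
    ⊆─ : ess C (Y ─ X) ⊆ ess W Y ─ X
    ⊆─ e∈ with to (∈-ess C) e∈
    ... | e∈Y─X , notColoop = let e∉X = x∈p─q⇒x∉q e∈Y─X in
      x∈p∧x∉q⇒x∈p─q (from (∈-ess W) (p─q⊆p Y X e∈Y─X , to (notColoop-contract X⊆Y e∉X) notColoop)) e∉X
    ─⊆ : ess W Y ─ X ⊆ ess C (Y ─ X)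
    ─⊆ e∈ with to (∈-ess W) (p─q⊆p (ess W Y) X e∈)
    ... | e∈Y , notColoop = let e∉X = x∈p─q⇒x∉q e∈ in
      from (∈-ess C) (x∈p∧x∉q⇒x∈p─q e∈Y e∉X , from (notColoop-contract X⊆Y e∉X) notColoop)

  ess≡⇔ess-contract≡⊥ : ∀ {Y} → (∀ e → e ∈ X → NotColoopIn W X e) → X ⊆ Y →
                        ess W Y ≡ X ⇔ ess C (Y ─ X) ≡ ⊥
  ess≡⇔ess-contract≡⊥ {Y} X-cyclic X⊆Y = mk⇔
    (λ eq → trans (ess-contract X⊆Y) (trans (cong (_─ X) eq) (p─p≡⊥ X)))
    (λ eq → ⊆-antisym (p─q≡⊥⇒p⊆q (trans (sym (ess-contract X⊆Y)) eq)) (cyclic⇒⊆ess M X-cyclic X⊆Y))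

  inCloud-contract : ∀ {Y k} → IsCyclicFlat W X → X ⊆ Y → InCloud W X k Y ⇔ InCloud C ⊥ k (Y ─ X)
  inCloud-contract (_ , X-cyclic) X⊆Y =
    flat-contract X⊆Y ×-⇔ ess≡⇔ess-contract≡⊥ X-cyclic X⊆Y
                     ×-⇔ mk⇔ (trans (corank-contract X⊆Y)) (trans (sym (corank-contract X⊆Y)))

  cloud-contract : IsCyclicFlat W X → ∀ k → cloud W X k ≡ cloud C ⊥ k
  cloud-contract X-cyclicFlat k = trans (count-≐ {n} (⇒ , ⇐)) (count-⊕ X _)
    where
    ⇒ : ∀ {Y} → InCloud W X k Y → InCloud C ⊥ k (Y ⊕ X)
    ⇒ {Y} inCloud@(_ , ess≡X , _) =
      let X⊆Y = ⊆-trans (⊆-reflexive (sym ess≡X)) (ess⊆ W Y) in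
      subst (InCloud C ⊥ k) (sym (q⊆p⇒p⊕q≡p─q X⊆Y)) (to (inCloud-contract X-cyclicFlat X⊆Y) inCloud)
    ⇐ : ∀ {Y} → InCloud C ⊥ k (Y ⊕ X) → InCloud W X k Y
    ⇐ {Y} inCloud@((Y⊕X⊆∁X , _) , _) =
      let X⊆Y = p⊕q⊆∁q⇒q⊆p Y⊕X⊆∁X in
      from (inCloud-contract X-cyclicFlat X⊆Y) (subst (InCloud C ⊥ k) (q⊆p⇒p⊕q≡p─q X⊆Y) inCloud)

lemma3p2 : ∀ {n} (M : Matroid n) → Loopless M → Coloopless M →
    (X : Subset n) → IsCyclicFlat (whole M) X →
    (∀ (k : ℕ) → cloud (whole M) X k ≡ cloud (contract M X) ⊥ k)
    × (∀ (k : ℕ) → flock (whole M) X k ≡ flock (restrict M X) X k)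
lemma3p2 M _ _ X X-cyclicFlat = cloud-contract M X X-cyclicFlat , flock-restrict M (proj₁ X-cyclicFlat)
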